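{- Let $\mathcal{C},\mathcal{D}$ be categories and $F\colon\mathcal{C}\to\mathcal{D}^{op}$ left adjoint to $G\colon\mathcal{D}^{op}\to\mathcal{C}$, with unit $\eta^{FG}$ and counit $\varepsilon$. Let $A$ be an endofunctor on $\mathcal{C}$ with initial algebra $\beta\colon A(\Psi)\xrightarrow{\cong}\Psi$, $(T,\eta,\mu)$ a monad on $\mathcal{C}$, $\lambda\colon AT\Rightarrow TA$ a Kleisli law with extension $\overline{A}$ to $\mathcal{K}\ell(T)$ such that $(\Psi,J(\beta^{ -1}))$ is a final $\overline{A}$-coalgebra, $L$ an endofunctor on $\mathcal{D}$ (also regarded as an endofunctor of $\mathcal{D}^{op}$) with an initial algebra, $\delta\colon AG\Rightarrow GL$ a natural transformation, and $\tau\colon TG\Rightarrow G$ a monad action. Then $\delta\circ A\tau=\tau L\circ T\delta\circ\lambda G$ (as natural transformations $ATG\Rightarrow GL$) holds if and only if there is a natural transformation $\widehat{\delta}\colon\widehat{F}\overline{A}\Rightarrow L\widehat{F}$ of functors $\mathcal{K}\ell(T)\to\mathcal{D}^{op}$ (equivalently a family of $\mathcal{D}$-morphisms $\widehat\delta_X\colon LF(X)\to FA(X)$) such that $\widehat{\delta}_X=(\delta_2)_X$ for every object $X$ of $\mathcal{C}$.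
   Context: A Kleisli law satisfies $\lambda\circ A\eta=\eta A$ and $\lambda\circ A\mu=\mu A\circ T\lambda\circ\lambda T$; its extension $\overline{A}\colon\mathcal{K}\ell(T)\to\mathcal{K}\ell(T)$ acts as $A$ on objects and sends a Kleisli map $f\colon X\to T(Y)$ to $\lambda_Y\circ A(f)$; $J\colon\mathcal{C}\to\mathcal{K}\ell(T)$ is identity on objects, $J(f)=\eta\circ f$. A monad action satisfies $\tau\circ\eta G=\mathrm{id}$ and $\tau\circ\mu G=\tau\circ T\tau$. The extension $\widehat{F}\colon\mathcal{K}\ell(T)\to\mathcal{D}^{op}$ of $F$ determined by $\tau$ is $\widehat F(X)=F(X)$ on objects, and sends a Kleisli map $f\colon X\to T(Y)$ to the morphism $F(X)\to F(Y)$ of $\mathcal{D}^{op}$ whose adjoint transpose $X\to GF(Y)$ is $\tau_{F(Y)}\circ T(\eta^{FG}_Y)\circ f$. The mate $\delta_2\colon FA\Rightarrow LF$ (a natural transformation of functors $\mathcal{C}\to\mathcal{D}^{op}$, i.e. with components $LF(X)\to FA(X)$ in $\mathcal{D}$) is $\delta_2=\varepsilon LF\circ F\delta F\circ FA\eta^{FG}$, composed in $\mathcal{D}^{op}$. -}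

module Defs where

open import Level using (Level; _⊔_) renaming (suc to lsuc)
open import Relation.Binary using (Rel; IsEquivalence)
open import Data.Product using (Σ; Σ-syntax; _×_; _,_)

record Category (o ℓ e : Level) : Set (lsuc (o ⊔ ℓ ⊔ e)) where
  infixr 9 _∘_
  infix  4 _≈_
  field
    Obj : Set o
    _⇒_ : Obj → Obj → Set ℓ
    _≈_ : ∀ {A B} → Rel (A ⇒ B) e
    id  : ∀ {A} → A ⇒ A
    _∘_ : ∀ {A B C} → B ⇒ C → A ⇒ B → A ⇒ C
    assoc     : ∀ {A B C D} {f : A ⇒ B} {g : B ⇒ C} {h : C ⇒ D} →
                (h ∘ g) ∘ f ≈ h ∘ (g ∘ f)
    identityˡ : ∀ {A B} {f : A ⇒ B} → id ∘ f ≈ f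
    identityʳ : ∀ {A B} {f : A ⇒ B} → f ∘ id ≈ f
    equiv     : ∀ {A B} → IsEquivalence (_≈_ {A} {B})
    ∘-resp-≈  : ∀ {A B C} {f h : B ⇒ C} {g i : A ⇒ B} →
                f ≈ h → g ≈ i → f ∘ g ≈ h ∘ i

  module Equiv {A B : Obj} = IsEquivalence (equiv {A} {B})

_op : ∀ {o ℓ e} → Category o ℓ e → Category o ℓ e
C op = record
  { Obj = Obj
  ; _⇒_ = λ A B → B ⇒ A
  ; _≈_ = _≈_
  ; id = id
  ; _∘_ = λ f g → g ∘ f
  ; assoc = Equiv.sym assoc
  ; identityˡ = identityʳ
  ; identityʳ = identityˡ
  ; equiv = equiv
  ; ∘-resp-≈ = λ p q → ∘-resp-≈ q p
  }
  where open Category C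

record Functor {o ℓ e o′ ℓ′ e′} (C : Category o ℓ e) (D : Category o′ ℓ′ e′)
       : Set (o ⊔ ℓ ⊔ e ⊔ o′ ⊔ ℓ′ ⊔ e′) where
  private
    module C = Category C
    module D = Category D
  field
    F₀ : C.Obj → D.Obj
    F₁ : ∀ {A B} → A C.⇒ B → F₀ A D.⇒ F₀ B
    identity     : ∀ {A} → F₁ (C.id {A}) D.≈ D.id
    homomorphism : ∀ {X Y Z} {f : X C.⇒ Y} {g : Y C.⇒ Z} →
                   F₁ (g C.∘ f) D.≈ F₁ g D.∘ F₁ f
    F-resp-≈     : ∀ {A B} {f g : A C.⇒ B} → f C.≈ g → F₁ f D.≈ F₁ g

idF : ∀ {o ℓ e} {C : Category o ℓ e} → Functor C C
idF {C = C} = record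
  { F₀ = λ X → X ; F₁ = λ f → f
  ; identity = Equiv.refl ; homomorphism = Equiv.refl ; F-resp-≈ = λ p → p }
  where open Category C

_∘F_ : ∀ {o ℓ e o′ ℓ′ e′ o″ ℓ″ e″}
         {C : Category o ℓ e} {D : Category o′ ℓ′ e′} {E : Category o″ ℓ″ e″} →
       Functor D E → Functor C D → Functor C E
_∘F_ {E = E} G F = record
  { F₀ = λ X → G.F₀ (F.F₀ X)
  ; F₁ = λ f → G.F₁ (F.F₁ f)
  ; identity = E.Equiv.trans (G.F-resp-≈ F.identity) G.identity
  ; homomorphism = E.Equiv.trans (G.F-resp-≈ F.homomorphism) G.homomorphism
  ; F-resp-≈ = λ p → G.F-resp-≈ (F.F-resp-≈ p)
  }
  where
    module G = Functor G
    module F = Functor F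
    module E = Category E

Functor-op : ∀ {o ℓ e o′ ℓ′ e′} {C : Category o ℓ e} {D : Category o′ ℓ′ e′} →
             Functor C D → Functor (C op) (D op)
Functor-op F = record
  { F₀ = F₀ ; F₁ = F₁ ; identity = identity
  ; homomorphism = homomorphism ; F-resp-≈ = F-resp-≈ }
  where open Functor F

record NaturalTransformation {o ℓ e o′ ℓ′ e′}
       {C : Category o ℓ e} {D : Category o′ ℓ′ e′} (F G : Functor C D)
       : Set (o ⊔ ℓ ⊔ e ⊔ o′ ⊔ ℓ′ ⊔ e′) where
  private
    module C = Category C
    module D = Category D
    module F = Functor F
    module G = Functor G
  field
    η       : ∀ X → F.F₀ X D.⇒ G.F₀ X
    commute : ∀ {X Y} (f : X C.⇒ Y) → η Y D.∘ F.F₁ f D.≈ G.F₁ f D.∘ η X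

record Adjunction {o ℓ e o′ ℓ′ e′} {C : Category o ℓ e} {D : Category o′ ℓ′ e′}
       (F : Functor C D) (G : Functor D C) : Set (o ⊔ ℓ ⊔ e ⊔ o′ ⊔ ℓ′ ⊔ e′) where
  private
    module C = Category C
    module D = Category D
    module F = Functor F
    module G = Functor G
  field
    unit   : NaturalTransformation idF (G ∘F F)
    counit : NaturalTransformation (F ∘F G) idF
  module unit   = NaturalTransformation unit
  module counit = NaturalTransformation counit
  field
    zig : ∀ {X} → counit.η (F.F₀ X) D.∘ F.F₁ (unit.η X) D.≈ D.id
    zag : ∀ {Y} → G.F₁ (counit.η Y) C.∘ unit.η (G.F₀ Y) C.≈ C.id

record Monad {o ℓ e} (C : Category o ℓ e) : Set (o ⊔ ℓ ⊔ e) where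
  open Category C
  field
    F : Functor C C
    η : NaturalTransformation idF F
    μ : NaturalTransformation (F ∘F F) F
  open Functor F public
  module η = NaturalTransformation η
  module μ = NaturalTransformation μ
  field
    assoc     : ∀ {X} → μ.η X ∘ F₁ (μ.η X) ≈ μ.η X ∘ μ.η (F₀ X)
    identityˡ : ∀ {X} → μ.η X ∘ F₁ (η.η X) ≈ id
    identityʳ : ∀ {X} → μ.η X ∘ η.η (F₀ X) ≈ id

module KleisliOps {o ℓ e} {C : Category o ℓ e} (T : Monad C) where
  open Category C
  open Monad T

  KlHom : Obj → Obj → Set ℓ
  KlHom X Y = X ⇒ F₀ Y

  _∘K_ : ∀ {X Y Z} → KlHom Y Z → KlHom X Y → KlHom X Z
  g ∘K f = μ.η _ ∘ (F₁ g ∘ f)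

  J : ∀ {X Y} → X ⇒ Y → KlHom X Y
  J f = η.η _ ∘ f

record KleisliLaw {o ℓ e} {C : Category o ℓ e} (A : Functor C C) (T : Monad C)
       : Set (o ⊔ ℓ ⊔ e) where
  open Category C
  private
    module A = Functor A
    module T = Monad T
  field
    law : NaturalTransformation (A ∘F T.F) (T.F ∘F A)
  open NaturalTransformation law public renaming (η to λ′)
  field
    law-η : ∀ {X} → λ′ X ∘ A.F₁ (T.η.η X) ≈ T.η.η (A.F₀ X)
    law-μ : ∀ {X} → λ′ X ∘ A.F₁ (T.μ.η X) ≈
                    T.μ.η (A.F₀ X) ∘ (T.F₁ (λ′ X) ∘ λ′ (T.F₀ X))

  Ā₁ : ∀ {X Y} → X ⇒ T.F₀ Y → A.F₀ X ⇒ T.F₀ (A.F₀ Y)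
  Ā₁ {Y = Y} f = λ′ Y ∘ A.F₁ f

record MonadAction {o ℓ e o′ ℓ′ e′} {C : Category o ℓ e} {E : Category o′ ℓ′ e′}
       (T : Monad C) (G : Functor E C) : Set (o ⊔ ℓ ⊔ e ⊔ o′ ⊔ ℓ′ ⊔ e′) where
  open Category C
  private
    module T = Monad T
    module G = Functor G
  field
    action : NaturalTransformation (T.F ∘F G) G
  open NaturalTransformation action public renaming (η to τ)
  field
    act-η : ∀ {Y} → τ Y ∘ T.η.η (G.F₀ Y) ≈ id
    act-μ : ∀ {Y} → τ Y ∘ T.μ.η (G.F₀ Y) ≈ τ Y ∘ T.F₁ (τ Y)

IsInitialAlgebra : ∀ {o ℓ e} {C : Category o ℓ e} (A : Functor C C) →
                   (Ψ : Category.Obj C) → Category._⇒_ C (Functor.F₀ A Ψ) Ψ →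
                   Set (o ⊔ ℓ ⊔ e)
IsInitialAlgebra {C = C} A Ψ β =
  ∀ (X : Obj) (a : F₀ X ⇒ X) →
    Σ[ h ∈ Ψ ⇒ X ] ((h ∘ β ≈ a ∘ F₁ h) ×
                    (∀ (h′ : Ψ ⇒ X) → h′ ∘ β ≈ a ∘ F₁ h′ → h′ ≈ h))
  where open Category C
        open Functor A

HasInitialAlgebra : ∀ {o ℓ e} {C : Category o ℓ e} (A : Functor C C) → Set (o ⊔ ℓ ⊔ e)
HasInitialAlgebra {C = C} A =
  Σ[ Ψ ∈ Obj ] Σ[ β ∈ Functor.F₀ A Ψ ⇒ Ψ ] IsInitialAlgebra A Ψ β
  where open Category C

IsFinalĀCoalgebra : ∀ {o ℓ e} {C : Category o ℓ e} {A : Functor C C} {T : Monad C} →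
                    KleisliLaw A T → (Ψ : Category.Obj C) →
                    KleisliOps.KlHom T Ψ (Functor.F₀ A Ψ) → Set (o ⊔ ℓ ⊔ e)
IsFinalĀCoalgebra {C = C} {A} {T} Λ Ψ c =
  ∀ (X : Obj) (d : KlHom X (Functor.F₀ A X)) →
    Σ[ h ∈ KlHom X Ψ ] ((c ∘K h ≈ Ā₁ h ∘K d) ×
                        (∀ (h′ : KlHom X Ψ) → c ∘K h′ ≈ Ā₁ h′ ∘K d → h′ ≈ h))
  where open Category C
        open KleisliOps T
        open KleisliLaw Λ

module Lemma7p8Ops
  {o ℓ e o′ ℓ′ e′} {C : Category o ℓ e} {D : Category o′ ℓ′ e′}
  {F : Functor C (D op)} {G : Functor (D op) C} (adj : Adjunction F G)
  {A : Functor C C} {T : Monad C} (Λ : KleisliLaw A T)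
  {L : Functor D D} (δ : NaturalTransformation (A ∘F G) (G ∘F Functor-op L))
  (Τ : MonadAction T G) where

  private
    module C  = Category C
    module Dᵒ = Category (D op)
    module F  = Functor F
    module G  = Functor G
    module A  = Functor A
    module T  = Monad T
    module Lᵒ = Functor (Functor-op L)
    module δ  = NaturalTransformation δ
    open Adjunction adj
    open KleisliLaw Λ
    open MonadAction Τ

  -- F̂ f : F X → F Y in D^op, the morphism whose adjoint transpose is
  -- τ_{F Y} ∘ T(η_Y) ∘ f ; the transpose of k : X → G Z is ε_Z ∘ F k
  F̂₁ : ∀ {X Y} → X C.⇒ T.F₀ Y → F.F₀ X Dᵒ.⇒ F.F₀ Y
  F̂₁ {Y = Y} f =
    counit.η (F.F₀ Y) Dᵒ.∘ F.F₁ (τ (F.F₀ Y) C.∘ (T.F₁ (unit.η Y) C.∘ f))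

  δ₂ : ∀ X → F.F₀ (A.F₀ X) Dᵒ.⇒ Lᵒ.F₀ (F.F₀ X)
  δ₂ X = counit.η (Lᵒ.F₀ (F.F₀ X))
         Dᵒ.∘ (F.F₁ (δ.η (F.F₀ X)) Dᵒ.∘ F.F₁ (A.F₁ (unit.η X)))

  -- a family δ̂_X : F(A X) → L(F X) in D^op is natural as a transformation
  -- F̂ Ā ⇒ L F̂ of functors Kl(T) → D^op
  IsNaturalKl : (∀ X → F.F₀ (A.F₀ X) Dᵒ.⇒ Lᵒ.F₀ (F.F₀ X)) → Set (o ⊔ ℓ ⊔ e′)
  IsNaturalKl δ̂ = ∀ {X Y} (f : X C.⇒ T.F₀ Y) →
    δ̂ Y Dᵒ.∘ F̂₁ (Ā₁ f) Dᵒ.≈ Lᵒ.F₁ (F̂₁ f) Dᵒ.∘ δ̂ X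

{-# OPTIONS --safe #-}
-- Transposing along F ⊣ G, the naturality square of δ₂ at a Kleisli map f : X → T Y
-- becomes the equation δ ∘ Aτ = τL ∘ Tδ ∘ λG at F Y, precomposed with A(T η_Y ∘ f).
-- Hence the law makes δ₂ natural. Conversely, naturality at the Kleisli identities
-- says that the two sides agree after A T η; both sides are natural in the object of D,
-- and G ε ∘ η G = id, so they agree everywhere.
module Submission where

open import Defs
open import Data.Product using (Σ; Σ-syntax; _×_; _,_)
open import Function.Bundles using (_⇔_; mk⇔; Equivalence)
open import Relation.Binary.Bundles using (Setoid)
import Relation.Binary.Reasoning.Setoid as SetoidReasoning

module MorphismReasoning {o ℓ e} (C : Category o ℓ e) where
  open Category C

  hom-setoid : ∀ {X Y} → Setoid ℓ e
  hom-setoid {X} {Y} = record { Carrier = X ⇒ Y ; _≈_ = _≈_ ; isEquivalence = equiv }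

  module HomReasoning {X Y : Obj} = SetoidReasoning (hom-setoid {X} {Y})

  infixr 4 refl⟩∘⟨_
  infixl 5 _⟩∘⟨refl

  refl⟩∘⟨_ : ∀ {X Y Z} {f : Y ⇒ Z} {g h : X ⇒ Y} → g ≈ h → f ∘ g ≈ f ∘ h
  refl⟩∘⟨ p = ∘-resp-≈ Equiv.refl p

  _⟩∘⟨refl : ∀ {X Y Z} {f g : Y ⇒ Z} {h : X ⇒ Y} → f ≈ g → f ∘ h ≈ g ∘ h
  p ⟩∘⟨refl = ∘-resp-≈ p Equiv.refl

  module _ {W X Y Z : Obj} where

    pullˡ : {a : Y ⇒ Z} {b : X ⇒ Y} {c : X ⇒ Z} {f : W ⇒ X} →
            a ∘ b ≈ c → a ∘ (b ∘ f) ≈ c ∘ f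
    pullˡ p = Equiv.trans (Equiv.sym assoc) (p ⟩∘⟨refl)

    pushˡ : {a : Y ⇒ Z} {b : X ⇒ Y} {c : X ⇒ Z} {f : W ⇒ X} →
            c ≈ a ∘ b → c ∘ f ≈ a ∘ (b ∘ f)
    pushˡ p = Equiv.sym (pullˡ (Equiv.sym p))

    pushʳ : {a : X ⇒ Y} {b : W ⇒ X} {c : W ⇒ Y} {f : Y ⇒ Z} →
            c ≈ a ∘ b → f ∘ c ≈ (f ∘ a) ∘ b
    pushʳ p = Equiv.trans (refl⟩∘⟨ p) (Equiv.sym assoc)

    extendʳ : ∀ {V} {a : Y ⇒ Z} {b : X ⇒ Y} {c : V ⇒ Z} {d : X ⇒ V} {f : W ⇒ X} →
              a ∘ b ≈ c ∘ d → a ∘ (b ∘ f) ≈ c ∘ (d ∘ f)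
    extendʳ p = Equiv.trans (pullˡ p) assoc

  glue : ∀ {U V W X Y Z} {f₁ : V ⇒ W} {f₂ : W ⇒ Z} {a : U ⇒ V} {b : X ⇒ W}
           {c : Y ⇒ Z} {g₁ : U ⇒ X} {g₂ : X ⇒ Y} →
         f₂ ∘ b ≈ c ∘ g₂ → f₁ ∘ a ≈ b ∘ g₁ → (f₂ ∘ f₁) ∘ a ≈ c ∘ (g₂ ∘ g₁)
  glue right left =
    Equiv.trans assoc (Equiv.trans (refl⟩∘⟨ left) (extendʳ right))

module _ {o ℓ e o′ ℓ′ e′} {C : Category o ℓ e} {D : Category o′ ℓ′ e′}
         (F : Functor C D) where
  open Category C
  private module D = Category D
  open Functor F

  map-square : ∀ {W X Y Z} {a : Y ⇒ Z} {b : W ⇒ Y} {c : X ⇒ Z} {d : W ⇒ X} →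
               a ∘ b ≈ c ∘ d → F₁ a D.∘ F₁ b D.≈ F₁ c D.∘ F₁ d
  map-square p = D.Equiv.trans (D.Equiv.sym homomorphism)
                   (D.Equiv.trans (F-resp-≈ p) homomorphism)

module AdjunctionProperties {o ℓ e o′ ℓ′ e′} {C : Category o ℓ e} {D : Category o′ ℓ′ e′}
         {F : Functor C D} {G : Functor D C} (adj : Adjunction F G) where
  private
    module C = Category C
    module D = Category D
    module F = Functor F
    module G = Functor G
  open Adjunction adj
  open MorphismReasoning C

  Ladjunct : ∀ {X Z} → F.F₀ X D.⇒ Z → X C.⇒ G.F₀ Z
  Ladjunct {X} h = G.F₁ h C.∘ unit.η X

  Radjunct : ∀ {X Z} → X C.⇒ G.F₀ Z → F.F₀ X D.⇒ Z
  Radjunct {Z = Z} k = counit.η Z D.∘ F.F₁ k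

  LRadjunct≈id : ∀ {X Z} (k : X C.⇒ G.F₀ Z) → Ladjunct (Radjunct k) C.≈ k
  LRadjunct≈id {X} {Z} k = begin
      G.F₁ (counit.η Z D.∘ F.F₁ k) C.∘ unit.η X
    ≈⟨ pushˡ G.homomorphism ⟩
      G.F₁ (counit.η Z) C.∘ (G.F₁ (F.F₁ k) C.∘ unit.η X)
    ≈⟨ refl⟩∘⟨ C.Equiv.sym (unit.commute k) ⟩
      G.F₁ (counit.η Z) C.∘ (unit.η (G.F₀ Z) C.∘ k)
    ≈⟨ pullˡ zag ⟩
      C.id C.∘ k
    ≈⟨ C.identityˡ ⟩
      k ∎
    where open HomReasoning

  RLadjunct≈id : ∀ {X Z} (h : F.F₀ X D.⇒ Z) → Radjunct (Ladjunct h) D.≈ h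
  RLadjunct≈id {X} {Z} h = begin
      counit.η Z D.∘ F.F₁ (G.F₁ h C.∘ unit.η X)
    ≈⟨ DR.refl⟩∘⟨ F.homomorphism ⟩
      counit.η Z D.∘ (F.F₁ (G.F₁ h) D.∘ F.F₁ (unit.η X))
    ≈⟨ DR.extendʳ (counit.commute h) ⟩
      h D.∘ (counit.η (F.F₀ X) D.∘ F.F₁ (unit.η X))
    ≈⟨ DR.refl⟩∘⟨ zig ⟩
      h D.∘ D.id
    ≈⟨ D.identityʳ ⟩
      h ∎
    where module DR = MorphismReasoning D
          open DR.HomReasoning

  Ladjunct-injective : ∀ {X Z} {h h′ : F.F₀ X D.⇒ Z} →
                       Ladjunct h C.≈ Ladjunct h′ → h D.≈ h′
  Ladjunct-injective {h = h} {h′} p =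
    D.Equiv.trans (D.Equiv.sym (RLadjunct≈id h))
      (D.Equiv.trans (D.∘-resp-≈ D.Equiv.refl (F.F-resp-≈ p)) (RLadjunct≈id h′))

  Ladjunct-∘ : ∀ {X Y Z} (h : Y D.⇒ Z) (g : F.F₀ X D.⇒ Y) →
               Ladjunct (h D.∘ g) C.≈ G.F₁ h C.∘ Ladjunct g
  Ladjunct-∘ h g = pushˡ G.homomorphism

  natural-≈-from-unit :
    {K : Functor C C} {M : Functor D C} →
    let module K = Functor K
        module M = Functor M in
    (α β : ∀ Z → K.F₀ (G.F₀ Z) C.⇒ M.F₀ Z) →
    (∀ {Z W} (h : Z D.⇒ W) → α W C.∘ K.F₁ (G.F₁ h) C.≈ M.F₁ h C.∘ α Z) →
    (∀ {Z W} (h : Z D.⇒ W) → β W C.∘ K.F₁ (G.F₁ h) C.≈ M.F₁ h C.∘ β Z) →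
    (∀ X → α (F.F₀ X) C.∘ K.F₁ (unit.η X) C.≈ β (F.F₀ X) C.∘ K.F₁ (unit.η X)) →
    ∀ Z → α Z C.≈ β Z
  natural-≈-from-unit {K} {M} α β α-natural β-natural α≈β-on-unit Z = begin
      α Z
    ≈⟨ through-unit α α-natural ⟩
      M.F₁ (counit.η Z) C.∘ (α (F.F₀ (G.F₀ Z)) C.∘ K.F₁ (unit.η (G.F₀ Z)))
    ≈⟨ refl⟩∘⟨ α≈β-on-unit (G.F₀ Z) ⟩
      M.F₁ (counit.η Z) C.∘ (β (F.F₀ (G.F₀ Z)) C.∘ K.F₁ (unit.η (G.F₀ Z)))
    ≈⟨ C.Equiv.sym (through-unit β β-natural) ⟩
      β Z ∎
    where
    module K = Functor K
    module M = Functor M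
    open HomReasoning
    through-unit : (γ : ∀ Z → K.F₀ (G.F₀ Z) C.⇒ M.F₀ Z) →
      (∀ {Z W} (h : Z D.⇒ W) → γ W C.∘ K.F₁ (G.F₁ h) C.≈ M.F₁ h C.∘ γ Z) →
      γ Z C.≈ M.F₁ (counit.η Z) C.∘ (γ (F.F₀ (G.F₀ Z)) C.∘ K.F₁ (unit.η (G.F₀ Z)))
    through-unit γ γ-natural = begin
        γ Z
      ≈⟨ C.Equiv.sym C.identityʳ ⟩
        γ Z C.∘ C.id
      ≈⟨ refl⟩∘⟨ C.Equiv.sym (C.Equiv.trans (K.F-resp-≈ zag) K.identity) ⟩
        γ Z C.∘ K.F₁ (G.F₁ (counit.η Z) C.∘ unit.η (G.F₀ Z))
      ≈⟨ refl⟩∘⟨ K.homomorphism ⟩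
        γ Z C.∘ (K.F₁ (G.F₁ (counit.η Z)) C.∘ K.F₁ (unit.η (G.F₀ Z)))
      ≈⟨ extendʳ (γ-natural (counit.η Z)) ⟩
        M.F₁ (counit.η Z) C.∘ (γ (F.F₀ (G.F₀ Z)) C.∘ K.F₁ (unit.η (G.F₀ Z))) ∎

module KleisliNaturality
  {o ℓ e o′ ℓ′ e′} {C : Category o ℓ e} {D : Category o′ ℓ′ e′}
  {F : Functor C (D op)} {G : Functor (D op) C} (adj : Adjunction F G)
  {A : Functor C C} {T : Monad C} (Λ : KleisliLaw A T)
  {L : Functor D D} (δ : NaturalTransformation (A ∘F G) (G ∘F Functor-op L))
  (Τ : MonadAction T G) where

  private
    module C  = Category C
    module Dᵒ = Category (D op)
    module F  = Functor F
    module G  = Functor G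
    module A  = Functor A
    module T  = Monad T
    module Lᵒ = Functor (Functor-op L)
    module δ  = NaturalTransformation δ
    module Λ  = KleisliLaw Λ
    module Τ  = MonadAction Τ
    open Adjunction adj using (unit)

  open Lemma7p8Ops adj Λ δ Τ
  open AdjunctionProperties adj
  open MorphismReasoning C

  δ∘Aτ : ∀ Z → A.F₀ (T.F₀ (G.F₀ Z)) C.⇒ G.F₀ (Lᵒ.F₀ Z)
  δ∘Aτ Z = δ.η Z C.∘ A.F₁ (Τ.τ Z)

  τ∘Tδ∘λ : ∀ Z → A.F₀ (T.F₀ (G.F₀ Z)) C.⇒ G.F₀ (Lᵒ.F₀ Z)
  τ∘Tδ∘λ Z = Τ.τ (Lᵒ.F₀ Z) C.∘ (T.F₁ (δ.η Z) C.∘ Λ.λ′ (G.F₀ Z))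

  δ∘Aτ-natural : ∀ {Z W} (h : Z Dᵒ.⇒ W) →
                 δ∘Aτ W C.∘ A.F₁ (T.F₁ (G.F₁ h)) C.≈ G.F₁ (Lᵒ.F₁ h) C.∘ δ∘Aτ Z
  δ∘Aτ-natural h = glue (δ.commute h) (map-square A (Τ.commute h))

  τ∘Tδ∘λ-natural : ∀ {Z W} (h : Z Dᵒ.⇒ W) →
                   τ∘Tδ∘λ W C.∘ A.F₁ (T.F₁ (G.F₁ h)) C.≈ G.F₁ (Lᵒ.F₁ h) C.∘ τ∘Tδ∘λ Z
  τ∘Tδ∘λ-natural h =
    glue (Τ.commute (Lᵒ.F₁ h)) (glue (map-square T.F (δ.commute h)) (Λ.commute (G.F₁ h)))

  Ladjunct-δ₂ : ∀ X → Ladjunct (δ₂ X) C.≈ δ.η (F.F₀ X) C.∘ A.F₁ (unit.η X)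
  Ladjunct-δ₂ X =
    C.Equiv.trans (G.F-resp-≈ (Dᵒ.∘-resp-≈ Dᵒ.Equiv.refl (Dᵒ.Equiv.sym F.homomorphism)) ⟩∘⟨refl)
                  (LRadjunct≈id _)

  module _ {X Y : C.Obj} (f : X C.⇒ T.F₀ Y) where
    open HomReasoning

    Ladjunct-δ₂∘F̂Ā : Ladjunct (δ₂ Y Dᵒ.∘ F̂₁ (Λ.Ā₁ f)) C.≈
                      τ∘Tδ∘λ (F.F₀ Y) C.∘ A.F₁ (T.F₁ (unit.η Y) C.∘ f)
    Ladjunct-δ₂∘F̂Ā = begin
        Ladjunct (δ₂ Y Dᵒ.∘ F̂₁ (Λ.Ā₁ f))
      ≈⟨ Ladjunct-∘ (δ₂ Y) _ ⟩
        G.F₁ (δ₂ Y) C.∘ Ladjunct (F̂₁ (Λ.Ā₁ f))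
      ≈⟨ refl⟩∘⟨ LRadjunct≈id _ ⟩
        G.F₁ (δ₂ Y) C.∘ (Τ.τ _ C.∘ (T.F₁ (unit.η (A.F₀ Y)) C.∘ Λ.Ā₁ f))
      ≈⟨ extendʳ (C.Equiv.sym (Τ.commute (δ₂ Y))) ⟩
        Τ.τ _ C.∘ (T.F₁ (G.F₁ (δ₂ Y)) C.∘ (T.F₁ (unit.η (A.F₀ Y)) C.∘ Λ.Ā₁ f))
      ≈⟨ refl⟩∘⟨ pullˡ (C.Equiv.sym T.homomorphism) ⟩
        Τ.τ _ C.∘ (T.F₁ (Ladjunct (δ₂ Y)) C.∘ Λ.Ā₁ f)
      ≈⟨ refl⟩∘⟨ T.F-resp-≈ (Ladjunct-δ₂ Y) ⟩∘⟨refl ⟩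
        Τ.τ _ C.∘ (T.F₁ (δ.η (F.F₀ Y) C.∘ A.F₁ (unit.η Y)) C.∘ (Λ.λ′ _ C.∘ A.F₁ f))
      ≈⟨ refl⟩∘⟨ pushˡ T.homomorphism ⟩
        Τ.τ _ C.∘ (T.F₁ (δ.η (F.F₀ Y)) C.∘ (T.F₁ (A.F₁ (unit.η Y)) C.∘ (Λ.λ′ _ C.∘ A.F₁ f)))
      ≈⟨ refl⟩∘⟨ refl⟩∘⟨ extendʳ (C.Equiv.sym (Λ.commute (unit.η Y))) ⟩
        Τ.τ _ C.∘ (T.F₁ (δ.η (F.F₀ Y)) C.∘ (Λ.λ′ _ C.∘ (A.F₁ (T.F₁ (unit.η Y)) C.∘ A.F₁ f)))
      ≈⟨ refl⟩∘⟨ refl⟩∘⟨ refl⟩∘⟨ C.Equiv.sym A.homomorphism ⟩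
        Τ.τ _ C.∘ (T.F₁ (δ.η (F.F₀ Y)) C.∘ (Λ.λ′ _ C.∘ A.F₁ (T.F₁ (unit.η Y) C.∘ f)))
      ≈⟨ C.Equiv.sym (C.Equiv.trans C.assoc (refl⟩∘⟨ C.assoc)) ⟩
        τ∘Tδ∘λ (F.F₀ Y) C.∘ A.F₁ (T.F₁ (unit.η Y) C.∘ f) ∎

    Ladjunct-LF̂∘δ₂ : Ladjunct (Lᵒ.F₁ (F̂₁ f) Dᵒ.∘ δ₂ X) C.≈
                      δ∘Aτ (F.F₀ Y) C.∘ A.F₁ (T.F₁ (unit.η Y) C.∘ f)
    Ladjunct-LF̂∘δ₂ = begin
        Ladjunct (Lᵒ.F₁ (F̂₁ f) Dᵒ.∘ δ₂ X)
      ≈⟨ Ladjunct-∘ (Lᵒ.F₁ (F̂₁ f)) (δ₂ X) ⟩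
        G.F₁ (Lᵒ.F₁ (F̂₁ f)) C.∘ Ladjunct (δ₂ X)
      ≈⟨ refl⟩∘⟨ Ladjunct-δ₂ X ⟩
        G.F₁ (Lᵒ.F₁ (F̂₁ f)) C.∘ (δ.η (F.F₀ X) C.∘ A.F₁ (unit.η X))
      ≈⟨ extendʳ (C.Equiv.sym (δ.commute (F̂₁ f))) ⟩
        δ.η (F.F₀ Y) C.∘ (A.F₁ (G.F₁ (F̂₁ f)) C.∘ A.F₁ (unit.η X))
      ≈⟨ refl⟩∘⟨ C.Equiv.sym A.homomorphism ⟩
        δ.η (F.F₀ Y) C.∘ A.F₁ (Ladjunct (F̂₁ f))
      ≈⟨ refl⟩∘⟨ A.F-resp-≈ (LRadjunct≈id _) ⟩
        δ.η (F.F₀ Y) C.∘ A.F₁ (Τ.τ _ C.∘ (T.F₁ (unit.η Y) C.∘ f))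
      ≈⟨ pushʳ A.homomorphism ⟩
        δ∘Aτ (F.F₀ Y) C.∘ A.F₁ (T.F₁ (unit.η Y) C.∘ f) ∎

  IsNaturalKl-resp-≈ : ∀ {δ̂ δ̂′ : ∀ X → F.F₀ (A.F₀ X) Dᵒ.⇒ Lᵒ.F₀ (F.F₀ X)} →
                       (∀ X → δ̂ X Dᵒ.≈ δ̂′ X) → IsNaturalKl δ̂ → IsNaturalKl δ̂′
  IsNaturalKl-resp-≈ δ̂≈δ̂′ natural {X} {Y} f =
    Dᵒ.Equiv.trans (Dᵒ.∘-resp-≈ (Dᵒ.Equiv.sym (δ̂≈δ̂′ Y)) Dᵒ.Equiv.refl)
      (Dᵒ.Equiv.trans (natural f) (Dᵒ.∘-resp-≈ Dᵒ.Equiv.refl (δ̂≈δ̂′ X)))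

  δ₂-natural⇔ : (∀ Z → δ∘Aτ Z C.≈ τ∘Tδ∘λ Z) ⇔ IsNaturalKl δ₂
  δ₂-natural⇔ = mk⇔ natural-if natural-only-if
    where
    open HomReasoning

    natural-if : (∀ Z → δ∘Aτ Z C.≈ τ∘Tδ∘λ Z) → IsNaturalKl δ₂
    natural-if δ∘Aτ≈τ∘Tδ∘λ {X} {Y} f = Ladjunct-injective (begin
        Ladjunct (δ₂ Y Dᵒ.∘ F̂₁ (Λ.Ā₁ f))
      ≈⟨ Ladjunct-δ₂∘F̂Ā f ⟩
        τ∘Tδ∘λ (F.F₀ Y) C.∘ A.F₁ (T.F₁ (unit.η Y) C.∘ f)
      ≈⟨ C.Equiv.sym (δ∘Aτ≈τ∘Tδ∘λ (F.F₀ Y)) ⟩∘⟨refl ⟩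
        δ∘Aτ (F.F₀ Y) C.∘ A.F₁ (T.F₁ (unit.η Y) C.∘ f)
      ≈⟨ C.Equiv.sym (Ladjunct-LF̂∘δ₂ f) ⟩
        Ladjunct (Lᵒ.F₁ (F̂₁ f) Dᵒ.∘ δ₂ X) ∎)

    natural-only-if : IsNaturalKl δ₂ → ∀ Z → δ∘Aτ Z C.≈ τ∘Tδ∘λ Z
    natural-only-if natural = natural-≈-from-unit {K = A ∘F T.F} {M = G ∘F Functor-op L}
      δ∘Aτ τ∘Tδ∘λ δ∘Aτ-natural τ∘Tδ∘λ-natural agree-on-unit
      where
      agree-on-unit : ∀ X → δ∘Aτ (F.F₀ X) C.∘ A.F₁ (T.F₁ (unit.η X)) C.≈
                            τ∘Tδ∘λ (F.F₀ X) C.∘ A.F₁ (T.F₁ (unit.η X))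
      agree-on-unit X = begin
          δ∘Aτ (F.F₀ X) C.∘ A.F₁ (T.F₁ (unit.η X))
        ≈⟨ refl⟩∘⟨ A.F-resp-≈ (C.Equiv.sym C.identityʳ) ⟩
          δ∘Aτ (F.F₀ X) C.∘ A.F₁ (T.F₁ (unit.η X) C.∘ C.id)
        ≈⟨ C.Equiv.sym (Ladjunct-LF̂∘δ₂ C.id) ⟩
          Ladjunct (Lᵒ.F₁ (F̂₁ C.id) Dᵒ.∘ δ₂ (T.F₀ X))
        ≈⟨ G.F-resp-≈ (Dᵒ.Equiv.sym (natural C.id)) ⟩∘⟨refl ⟩
          Ladjunct (δ₂ X Dᵒ.∘ F̂₁ (Λ.Ā₁ C.id))
        ≈⟨ Ladjunct-δ₂∘F̂Ā C.id ⟩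
          τ∘Tδ∘λ (F.F₀ X) C.∘ A.F₁ (T.F₁ (unit.η X) C.∘ C.id)
        ≈⟨ refl⟩∘⟨ A.F-resp-≈ C.identityʳ ⟩
          τ∘Tδ∘λ (F.F₀ X) C.∘ A.F₁ (T.F₁ (unit.η X)) ∎

lemma7p8 : ∀ {o ℓ e o′ ℓ′ e′} (C : Category o ℓ e) (D : Category o′ ℓ′ e′)
    (F : Functor C (D op)) (G : Functor (D op) C) (adj : Adjunction F G)
    (A : Functor C C) (Ψ : Category.Obj C)
    (β : Category._⇒_ C (Functor.F₀ A Ψ) Ψ)
    (β-initial : IsInitialAlgebra A Ψ β)
    (β⁻¹ : Category._⇒_ C Ψ (Functor.F₀ A Ψ))
    (β∘β⁻¹ : Category._≈_ C (Category._∘_ C β β⁻¹) (Category.id C))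
    (β⁻¹∘β : Category._≈_ C (Category._∘_ C β⁻¹ β) (Category.id C))
    (T : Monad C) (Λ : KleisliLaw A T)
    (final : IsFinalĀCoalgebra Λ Ψ (KleisliOps.J T β⁻¹))
    (L : Functor D D) (L-initial : HasInitialAlgebra L)
    (δ : NaturalTransformation (A ∘F G) (G ∘F Functor-op L))
    (τ : MonadAction T G) →
    (∀ (Y : Category.Obj D) →
       Category._≈_ C
         (Category._∘_ C (NaturalTransformation.η δ Y)
            (Functor.F₁ A (MonadAction.τ τ Y)))
         (Category._∘_ C (MonadAction.τ τ (Functor.F₀ L Y))
            (Category._∘_ C (Monad.F₁ T (NaturalTransformation.η δ Y))
               (KleisliLaw.λ′ Λ (Functor.F₀ G Y)))))
    ⇔
    (Σ[ δ̂ ∈ (∀ (X : Category.Obj C) →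
               Category._⇒_ (D op) (Functor.F₀ F (Functor.F₀ A X))
                 (Functor.F₀ L (Functor.F₀ F X))) ]
       (Lemma7p8Ops.IsNaturalKl adj Λ δ τ δ̂ ×
        (∀ (X : Category.Obj C) →
           Category._≈_ (D op) (δ̂ X) (Lemma7p8Ops.δ₂ adj Λ δ τ X))))
lemma7p8 C D F G adj A _ _ _ _ _ _ T Λ _ L _ δ τ = mk⇔
  (λ law → δ₂ , (λ {X} {Y} → to law {X} {Y}) , λ X → Category.Equiv.refl (D op))
  (λ { (δ̂ , δ̂-natural , δ̂≈δ₂) → from (IsNaturalKl-resp-≈ δ̂≈δ₂ δ̂-natural) })
  where
  open Lemma7p8Ops adj Λ δ τ using (δ₂)
  open KleisliNaturality adj Λ δ τ
  open Equivalence δ₂-natural⇔
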